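{- For any tree $T$ with $n$ vertices and any star $S$ with at least $n+1$ leaves, $$\operatorname{gm}(S\mathbin{\Box} T)\ge\lfloor\sqrt{2n}\rfloor.$$
   Context: A star is a tree consisting of one root vertex adjacent to all other vertices (the leaves). $\boxplus_k$ is the graph on $\{1,\dots,k\}^2$ with $(x,y)\sim(x',y')$ iff $|x-x'|+|y-y'|=1$; $\operatorname{gm}(G)$ is the maximum $k$ with $\boxplus_k$ a minor of $G$. The Cartesian product $G_1\mathbin{\Box} G_2$ has vertex set $V(G_1)\times V(G_2)$ with distinct $(u_1,u_2),(v_1,v_2)$ adjacent iff ($u_1=v_1$ and $u_2v_2\in E(G_2)$) or ($u_2=v_2$ and $u_1v_1\in E(G_1)$). -}

module Defs where

open import Data.Nat using (ℕ; zero; suc; _+_; _*_; _≤_; ∣_-_∣)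
open import Data.Nat.Properties using (∣n-n∣≡0; ∣-∣-comm)
open import Data.Fin using (Fin; zero; suc; toℕ; inject₁; fromℕ)
open import Data.Product using (Σ; ∃; ∃₂; _×_; _,_)
open import Data.Sum using (_⊎_; inj₁; inj₂)
open import Data.Unit using (⊤)
open import Data.Empty using (⊥)
open import Relation.Nullary using (¬_)
open import Relation.Binary.PropositionalEquality using (_≡_; refl; sym; cong₂)
open import Function.Definitions using (Injective)

record Graph (V : Set) : Set₁ where
  field
    Adj    : V → V → Set
    sym∼   : ∀ {u v} → Adj u v → Adj v u
    irrefl : ∀ {u} → ¬ Adj u u
open Graph public

-- Walks in G all of whose vertices lie in P (P = ⊤ for ordinary walks).
data Walk {V : Set} (G : Graph V) (P : V → Set) : V → V → Set where
  nil  : ∀ {u} → P u → Walk G P u u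
  cons : ∀ {u v w} → P u → Adj G u v → Walk G P v w → Walk G P u w

Connected : {V : Set} → Graph V → Set
Connected G = ∀ u v → Walk G (λ _ → ⊤) u v

Cycle : {V : Set} → Graph V → Set
Cycle {V} G = Σ ℕ λ k → Σ (Fin (3 + k) → V) λ c →
  Injective _≡_ _≡_ c
  × (∀ (i : Fin (2 + k)) → Adj G (c (inject₁ i)) (c (suc i)))
  × Adj G (c (fromℕ (2 + k))) (c zero)

IsTree : {V : Set} → Graph V → Set
IsTree G = Connected G × ¬ Cycle G

data StarAdj {m : ℕ} : Fin (suc m) → Fin (suc m) → Set where
  root-leaf : ∀ i → StarAdj zero (suc i)
  leaf-root : ∀ i → StarAdj (suc i) zero

Star : (m : ℕ) → Graph (Fin (suc m))
Star m = record { Adj = StarAdj ; sym∼ = sy ; irrefl = ir }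
  where
    sy : ∀ {u v} → StarAdj {m} u v → StarAdj v u
    sy (root-leaf i) = leaf-root i
    sy (leaf-root i) = root-leaf i
    ir : ∀ {u} → ¬ StarAdj {m} u u
    ir ()

_□_ : {A B : Set} → Graph A → Graph B → Graph (A × B)
_□_ {A} {B} G₁ G₂ = record { Adj = R ; sym∼ = sy ; irrefl = ir }
  where
    R : A × B → A × B → Set
    R (u₁ , u₂) (v₁ , v₂) = (u₁ ≡ v₁ × Adj G₂ u₂ v₂) ⊎ (u₂ ≡ v₂ × Adj G₁ u₁ v₁)
    sy : ∀ {u v} → R u v → R v u
    sy (inj₁ (refl , e)) = inj₁ (refl , sym∼ G₂ e)
    sy (inj₂ (refl , e)) = inj₂ (refl , sym∼ G₁ e)
    ir : ∀ {u} → ¬ R u u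
    ir (inj₁ (_ , e)) = irrefl G₂ e
    ir (inj₂ (_ , e)) = irrefl G₁ e

-- The k × k grid ⊞_k on {1..k}² (here Fin k × Fin k):
-- (x,y) ∼ (x',y') iff |x-x'| + |y-y'| = 1.
Grid : (k : ℕ) → Graph (Fin k × Fin k)
Grid k = record { Adj = R ; sym∼ = λ {u} {v} → sy {u} {v} ; irrefl = λ {u} → ir {u} }
  where
    R : Fin k × Fin k → Fin k × Fin k → Set
    R (x , y) (x′ , y′) = ∣ toℕ x - toℕ x′ ∣ + ∣ toℕ y - toℕ y′ ∣ ≡ 1
    sy : ∀ {u v} → R u v → R v u
    sy {x , y} {x′ , y′} e rewrite ∣-∣-comm (toℕ x′) (toℕ x) | ∣-∣-comm (toℕ y′) (toℕ y) = e
    ir : ∀ {u} → ¬ R u u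
    ir {x , y} e rewrite ∣n-n∣≡0 (toℕ x) | ∣n-n∣≡0 (toℕ y) with e
    ... | ()

record MinorModel {A B : Set} (H : Graph A) (G : Graph B) : Set₁ where
  field
    branch    : A → B → Set
    nonempty  : ∀ a → ∃ λ b → branch a b
    connected : ∀ a {b b′} → branch a b → branch a b′ → Walk G (branch a) b b′
    disjoint  : ∀ {a a′ b} → branch a b → branch a′ b → a ≡ a′
    edges     : ∀ {a a′} → Adj H a a′ →
                ∃₂ λ b b′ → branch a b × branch a′ b′ × Adj G b b′

_≼_ : {A B : Set} → Graph A → Graph B → Set₁
H ≼ G = MinorModel H G

-- gm(G) ≥ s  ⇔  some k ≥ s has ⊞_k as a minor of G (gm is the maximum such k).
gm≥ : {B : Set} → Graph B → ℕ → Set₁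
gm≥ G s = Σ ℕ λ k → s ≤ k × Grid k ≼ G

{-# OPTIONS --safe #-}
-- Colour the s × s grid like a chessboard. In Star m □ T every vertex (root, t)
-- is adjacent to every fibre {leaf} × T, and each fibre is connected; so a
-- bipartite graph is a minor as soon as its black vertices can be sent
-- injectively to vertices (root, t) and its white ones to distinct fibres.
-- Both chessboard classes fit into n slots: list the cells in boustrophedon
-- order, where the parity of a position is the colour of its cell, and send
-- the cell at position p to slot ⌊p/2⌋.
module Submission where

open import Defs
open import Data.Nat using (ℕ; suc; _+_; _*_; _≤_)
open import Data.Fin using (Fin)

open import Algebra using (CommutativeRing)
open import Data.Bool.Base using (Bool; true; false; not; _xor_; _∧_)
open import Data.Bool.Properties
  using (not-injective; xor-same; xor-assoc; xor-identityʳ; not-distribˡ-xor;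
         xor-annihilates-not; ∧-distribʳ-xor; ∧-zeroʳ; ∧-identityʳ; xor-∧-commutativeRing)
open import Data.Nat.Base using (zero; _<_; _∸_; ∣_-_∣; ⌊_/2⌋; z≤n; s≤s)
open import Data.Nat.Properties
  using (≤-refl; <⇒≤; <-≤-trans; +-identityʳ; suc-injective; ⌊n/2⌋-mono; n≡⌈n+n/2⌉)
open import Data.Fin.Base using (zero; suc; toℕ; fromℕ<; combine; opposite; inject≤)
open import Data.Fin.Properties
  using (toℕ<n; toℕ-injective; fromℕ<-injective; toℕ-combine; combine-injective;
         opposite-prop; opposite-involutive; inject≤-injective)
  renaming (suc-injective to fsuc-injective)
open import Data.Product using (∃; ∃₂; _×_; _,_; proj₁)
open import Data.Sum using (inj₁; inj₂)
open import Data.Unit using (⊤)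
open import Data.Empty using (⊥-elim)
open import Relation.Nullary using (contradiction)
open import Relation.Binary.PropositionalEquality
  using (_≡_; _≢_; refl; sym; trans; cong; cong₂; subst; module ≡-Reasoning)
open import Algebra.Properties.CommutativeSemigroup
  (CommutativeRing.+-commutativeSemigroup xor-∧-commutativeRing) using (interchange)

open ≡-Reasoning

parity : ℕ → Bool
parity zero    = false
parity (suc n) = not (parity n)

parity-+ : ∀ m n → parity (m + n) ≡ parity m xor parity n
parity-+ zero    n = refl
parity-+ (suc m) n = trans (cong not (parity-+ m n)) (not-distribˡ-xor (parity m) (parity n))

parity-* : ∀ m n → parity (m * n) ≡ parity m ∧ parity n
parity-* zero    n = refl
parity-* (suc m) n = begin
  parity (n + m * n)                 ≡⟨ parity-+ n (m * n) ⟩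
  parity n xor parity (m * n)        ≡⟨ cong (parity n xor_) (parity-* m n) ⟩
  parity n xor (parity m ∧ parity n) ≡⟨ ∧-distribʳ-xor (parity n) true (parity m) ⟨
  not (parity m) ∧ parity n          ∎

parity-∸ : ∀ {m n} → n ≤ m → parity (m ∸ n) ≡ parity m xor parity n
parity-∸ {m} z≤n             = sym (xor-identityʳ (parity m))
parity-∸ (s≤s {m} {n} n≤m) = trans (parity-∸ n≤m) (sym (xor-annihilates-not (parity n) (parity m)))

parity-∣-∣ : ∀ m n → parity ∣ m - n ∣ ≡ parity m xor parity n
parity-∣-∣ zero    n       = refl
parity-∣-∣ (suc m) zero    = sym (xor-identityʳ (not (parity m)))
parity-∣-∣ (suc m) (suc n) = trans (parity-∣-∣ m n) (sym (xor-annihilates-not (parity m) (parity n)))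

parity-neighbours : ∀ x y x′ y′ → ∣ x - x′ ∣ + ∣ y - y′ ∣ ≡ 1 → parity (x + y) ≢ parity (x′ + y′)
parity-neighbours x y x′ y′ d≡1 same = contradiction (begin
  false
    ≡⟨ xor-same (parity (x + y)) ⟨
  parity (x + y) xor parity (x + y)
    ≡⟨ cong (parity (x + y) xor_) same ⟩
  parity (x + y) xor parity (x′ + y′)
    ≡⟨ cong₂ _xor_ (parity-+ x y) (parity-+ x′ y′) ⟩
  (parity x xor parity y) xor (parity x′ xor parity y′)
    ≡⟨ interchange (parity x) (parity y) (parity x′) (parity y′) ⟩
  (parity x xor parity x′) xor (parity y xor parity y′)
    ≡⟨ cong₂ _xor_ (parity-∣-∣ x x′) (parity-∣-∣ y y′) ⟨
  parity ∣ x - x′ ∣ xor parity ∣ y - y′ ∣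
    ≡⟨ parity-+ ∣ x - x′ ∣ ∣ y - y′ ∣ ⟨
  parity (∣ x - x′ ∣ + ∣ y - y′ ∣)
    ≡⟨ cong parity d≡1 ⟩
  true ∎) λ ()

parity-⌊/2⌋-injective : ∀ m n → parity m ≡ parity n → ⌊ m /2⌋ ≡ ⌊ n /2⌋ → m ≡ n
parity-⌊/2⌋-injective zero          zero          _  _  = refl
parity-⌊/2⌋-injective zero          (suc zero)    () _
parity-⌊/2⌋-injective zero          (suc (suc n)) _  ()
parity-⌊/2⌋-injective (suc zero)    zero          () _
parity-⌊/2⌋-injective (suc zero)    (suc zero)    _  _  = refl
parity-⌊/2⌋-injective (suc zero)    (suc (suc n)) _  ()
parity-⌊/2⌋-injective (suc (suc m)) zero          _  ()
parity-⌊/2⌋-injective (suc (suc m)) (suc zero)    _  ()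
parity-⌊/2⌋-injective (suc (suc m)) (suc (suc n)) p  e =
  cong (λ k → suc (suc k))
       (parity-⌊/2⌋-injective m n (not-injective (not-injective p)) (suc-injective e))

⌊m/2⌋<n : ∀ {m n} → m < n + n → ⌊ m /2⌋ < n
⌊m/2⌋<n {m} {n} m<2n = subst (suc ⌊ m /2⌋ ≤_) (sym (n≡⌈n+n/2⌉ n)) (⌊n/2⌋-mono (s≤s m<2n))

record Bipartition {A : Set} (H : Graph A) (n : ℕ) : Set where
  field
    colour          : A → Bool
    proper          : ∀ {a a′} → Adj H a a′ → colour a ≢ colour a′
    index           : A → Fin n
    index-injective : ∀ {a a′} → colour a ≡ colour a′ → index a ≡ index a′ → a ≡ a′

module _ {n m : ℕ} {T : Graph (Fin n)} (T-connected : Connected T) (n≤m : n ≤ m) where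

  private
    G : Graph (Fin (suc m) × Fin n)
    G = Star m □ T

    leaf : Fin n → Fin (suc m)
    leaf i = suc (inject≤ i n≤m)

  Branch : Bool → Fin n → Fin (suc m) × Fin n → Set
  Branch true  i b = b ≡ (zero , i)
  Branch false i b = proj₁ b ≡ leaf i

  walk-in-fibre : ∀ r {t t′} → Walk T (λ _ → ⊤) t t′ → Walk G (λ b → proj₁ b ≡ r) (r , t) (r , t′)
  walk-in-fibre r (nil _)      = nil refl
  walk-in-fibre r (cons _ e w) = cons refl (inj₁ (refl , e)) (walk-in-fibre r w)

  Branch-nonempty : ∀ c i → ∃ (Branch c i)
  Branch-nonempty true  i = (zero , i) , refl
  Branch-nonempty false i = (leaf i , i) , refl

  Branch-connected : ∀ c i {b b′} → Branch c i b → Branch c i b′ → Walk G (Branch c i) b b′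
  Branch-connected true  i refl refl = nil refl
  Branch-connected false i {_ , t} {_ , t′} refl refl = walk-in-fibre (leaf i) (T-connected t t′)

  Branch-disjoint : ∀ c c′ i i′ {b} → Branch c i b → Branch c′ i′ b → c ≡ c′ × i ≡ i′
  Branch-disjoint true  true  i i′ refl refl = refl , refl
  Branch-disjoint true  false i i′ refl ()
  Branch-disjoint false true  i i′ refl ()
  Branch-disjoint false false i i′ e    e′ =
    refl , inject≤-injective n≤m n≤m i i′ (fsuc-injective (trans (sym e) e′))

  Branch-adjacent : ∀ c c′ i i′ → c ≢ c′ →
    ∃₂ λ b b′ → Branch c i b × Branch c′ i′ b′ × Adj G b b′
  Branch-adjacent true  true  i i′ c≢c′ = ⊥-elim (c≢c′ refl)
  Branch-adjacent true  false i i′ _    =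
    (zero , i) , (leaf i′ , i) , refl , refl , inj₂ (refl , root-leaf _)
  Branch-adjacent false true  i i′ _    =
    (leaf i , i′) , (zero , i′) , refl , refl , inj₂ (refl , leaf-root _)
  Branch-adjacent false false i i′ c≢c′ = ⊥-elim (c≢c′ refl)

  bipartite≼Star□ : ∀ {A} {H : Graph A} → Bipartition H n → H ≼ G
  bipartite≼Star□ {A} P = record
    { branch    = branch
    ; nonempty  = λ a → Branch-nonempty (colour a) (index a)
    ; connected = λ a → Branch-connected (colour a) (index a)
    ; disjoint  = λ {a} {a′} bₐ bₐ′ →
        let c≡c′ , i≡i′ = Branch-disjoint (colour a) (colour a′) (index a) (index a′) bₐ bₐ′
        in index-injective c≡c′ i≡i′
    ; edges     = λ {a} {a′} e → Branch-adjacent (colour a) (colour a′) (index a) (index a′) (proper e)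
    }
    where
      open Bipartition P
      branch : A → Fin (suc m) × Fin n → Set
      branch a = Branch (colour a) (index a)

module _ {s : ℕ} where

  turn : Bool → Fin s → Fin s
  turn false y = y
  turn true  y = opposite y

  turn-injective : ∀ b {y y′} → turn b y ≡ turn b y′ → y ≡ y′
  turn-injective false e = e
  turn-injective true {y} {y′} e = begin
    y                       ≡⟨ opposite-involutive y ⟨
    opposite (opposite y)   ≡⟨ cong opposite e ⟩
    opposite (opposite y′)  ≡⟨ opposite-involutive y′ ⟩
    y′                      ∎

  parity-opposite : ∀ (y : Fin s) → parity (toℕ (opposite y)) ≡ parity s xor not (parity (toℕ y))
  parity-opposite y = trans (cong parity (opposite-prop y)) (parity-∸ (toℕ<n y))

  parity-turn : ∀ b (y : Fin s) → (parity s ∧ b) xor parity (toℕ (turn b y)) ≡ b xor parity (toℕ y)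
  parity-turn false y = cong (_xor parity (toℕ y)) (∧-zeroʳ (parity s))
  parity-turn true  y = begin
    (parity s ∧ true) xor parity (toℕ (opposite y))
      ≡⟨ cong₂ _xor_ (∧-identityʳ (parity s)) (parity-opposite y) ⟩
    parity s xor (parity s xor not (parity (toℕ y)))
      ≡⟨ xor-assoc (parity s) (parity s) (not (parity (toℕ y))) ⟨
    (parity s xor parity s) xor not (parity (toℕ y))
      ≡⟨ cong (_xor not (parity (toℕ y))) (xor-same (parity s)) ⟩
    not (parity (toℕ y)) ∎

  chessboard : Fin s × Fin s → Bool
  chessboard (x , y) = parity (toℕ x + toℕ y)

  chessboard-proper : ∀ a a′ → Adj (Grid s) a a′ → chessboard a ≢ chessboard a′
  chessboard-proper (x , y) (x′ , y′) = parity-neighbours (toℕ x) (toℕ y) (toℕ x′) (toℕ y′)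

  boustrophedon : Fin s × Fin s → Fin (s * s)
  boustrophedon (x , y) = combine x (turn (parity (toℕ x)) y)

  boustrophedon-injective : ∀ {a a′} → boustrophedon a ≡ boustrophedon a′ → a ≡ a′
  boustrophedon-injective {x , y} {x′ , y′} e with combine-injective x _ x′ _ e
  ... | refl , e′ = cong (x ,_) (turn-injective (parity (toℕ x)) e′)

  parity-boustrophedon : ∀ a → parity (toℕ (boustrophedon a)) ≡ chessboard a
  parity-boustrophedon (x , y) = begin
    parity (toℕ (combine x (turn px y)))  ≡⟨ cong parity (toℕ-combine x (turn px y)) ⟩
    parity (s * toℕ x + z)                ≡⟨ parity-+ (s * toℕ x) z ⟩
    parity (s * toℕ x) xor parity z       ≡⟨ cong (_xor parity z) (parity-* s (toℕ x)) ⟩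
    (parity s ∧ px) xor parity z          ≡⟨ parity-turn px y ⟩
    px xor parity (toℕ y)                 ≡⟨ parity-+ (toℕ x) (toℕ y) ⟨
    parity (toℕ x + toℕ y)                ∎
    where
      px : Bool
      px = parity (toℕ x)
      z : ℕ
      z = toℕ (turn px y)

Grid-bipartition : ∀ {s n} → s * s ≤ 2 * n → Bipartition (Grid s) n
Grid-bipartition {s} {n} s²≤2n = record
  { colour          = chessboard
  ; proper          = λ {a} {a′} → chessboard-proper a a′
  ; index           = index
  ; index-injective = index-injective
  }
  where
    position : Fin s × Fin s → ℕ
    position a = toℕ (boustrophedon a)

    position<2n : ∀ a → position a < n + n
    position<2n a = <-≤-trans (toℕ<n (boustrophedon a))
                              (subst (s * s ≤_) (cong (n +_) (+-identityʳ n)) s²≤2n)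

    index : Fin s × Fin s → Fin n
    index a = fromℕ< (⌊m/2⌋<n (position<2n a))

    index-injective : ∀ {a a′} → chessboard a ≡ chessboard a′ → index a ≡ index a′ → a ≡ a′
    index-injective {a} {a′} same i≡i′ = boustrophedon-injective (toℕ-injective
      (parity-⌊/2⌋-injective (position a) (position a′)
        (trans (parity-boustrophedon a) (trans same (sym (parity-boustrophedon a′))))
        (fromℕ<-injective _ _ _ _ i≡i′)))

corollary15 : (n : ℕ) (T : Graph (Fin n)) → IsTree T →
    (m : ℕ) → suc n ≤ m →
    (s : ℕ) → s * s ≤ 2 * n → gm≥ (Star m □ T) s
corollary15 n T (T-connected , _) m n<m s s²≤2n =
  s , ≤-refl , bipartite≼Star□ T-connected (<⇒≤ n<m) (Grid-bipartition s²≤2n)
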